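{- Let $S$ be a $^+1$-monoid, $r\ge0$, $n\ge0$. Let $(\mathbf{V},\pi)\in\Pi_{S,r}(n)$ with $\pi$ having $k$ blocks, and let $(\boldsymbol{\ell},\sigma)\in\mathbf{P}_{S,r}(n)$ with $\sigma$ having $k$ cycles. Then for every $j$, $$|\{(\mathbf{V}',\pi')\in\Pi_{S,r}(n):(\mathbf{V}',\pi')\ge(\mathbf{V},\pi),\ \pi'\text{ has } j \text{ blocks}\}|=|\Pi_{S,r}(k,j)|,$$ $$|\{(\boldsymbol{\ell}',\sigma')\in\mathbf{P}_{S,r}(n):(\boldsymbol{\ell}',\sigma')\ge(\boldsymbol{\ell},\sigma),\ \sigma'\text{ has } j\text{ cycles}\}|=|\mathbf{P}_{S,r}(k,j)|.$$
   Context: A set $S\subseteq\mathbb{Z}^+$ is a $^+1$-monoid if $1\in S$ and for every $\ell\in S$ and $s_1,\dots,s_\ell\in S$ we have $\sum_j s_j\in S$. Let $S'=\{s-1:s\in S\}$. An $r$-composition of a set $V$ is an $r$-tuple $(V_1,\dots,V_r)$ of pairwise disjoint, possibly empty sets with union $V$. $\Pi_{S,r}(n)$ is the set of pairs $(\mathbf{V},\pi)$ where $\mathbf{V}=(V_1,\dots,V_r)$ is an $r$-composition of a subset $V\subseteq[n]$ with all $|V_i|\in S'$ and $\pi$ is a partition of $[n]\setminus V$ with all block sizes in $S$; $\Pi_{S,r}(n,k)$ is the subset where $\pi$ has $k$ blocks (so $|\Pi_{S,r}(n,k)|={n\brace k}_{S,r}$). Order: $(\mathbf{V},\pi)\le(\mathbf{V}',\pi')$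 iff each $V'_i$ is the union of $V_i$ with $t_i$ blocks of $\pi$ for some $t_i\in S'$, and each block of $\pi'$ is the union of $s$ blocks of $\pi$ for some $s\in S$. Cycles are written as words starting with their least element; a linear order is a word. $\mathbf{P}_{S,r}(n)$ is the set of pairs $(\boldsymbol{\ell},\sigma)$ where $\boldsymbol{\ell}=(\ell_1,\dots,\ell_r)$, $\ell_i$ a linear order on $V_i$, $(V_1,\dots,V_r)$ an $r$-composition of some $V\subseteq[n]$ with all $|V_i|\in S'$, and $\sigma$ a permutation of $[n]\setminus V$ with all cycle lengths in $S$; $\mathbf{P}_{S,r}(n,k)$ is the subset where $\sigma$ has $k$ cycles. Order: $(\boldsymbol{\ell},\sigma)\le(\boldsymbol{\ell}',\sigma')$ iff each $\ell'_i$ is the concatenation of $\ell_i$ followed by $t_i$ cycles of $\sigma$ (each written as a word) in some order, $t_i\in S'$, and each cycle of $\sigma'$ is obtained by concatenating the words of $s$ cycles of $\sigma$ in some order and closing into a cycle, $s\in S$. (Pairs over a $k$-element set are defined analogously with $[k]$ in place of $[n]$.) -}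

module Defs where

open import Level using (0ℓ)
open import Data.Nat using (ℕ; suc; _≤_)
open import Data.Fin using (Fin; _<_)
open import Data.Vec using (Vec; lookup; toList)
open import Data.List using (List; []; _∷_; _++_; concat; length; allFin)
open import Data.Nat.ListAction using (sum)
open import Data.List.Membership.Propositional using (_∈_)
open import Data.List.Relation.Unary.All using (All)
open import Data.List.Relation.Unary.Any using (Any)
open import Data.List.Relation.Unary.Linked using (Linked)
open import Data.List.Relation.Unary.Unique.Propositional using (Unique)
open import Data.List.Relation.Binary.Permutation.Propositional using (_↭_)
open import Data.Product using (Σ; ∃; ∃₂; _×_; _,_)
open import Data.Sum using (_⊎_)
open import Data.Empty using (⊥)
open import Relation.Nullary using (¬_)
open import Relation.Binary.PropositionalEquality using (_≡_)
open import Function.Bundles using (_⇔_)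
open import Data.Refinement using (Refinement)

record PlusOneMonoid (S : ℕ → Set) : Set where
  field
    positive : ∀ s → S s → 1 ≤ s
    one∈S    : S 1
    closed   : ∀ ℓ → S ℓ → (ss : List ℕ) → length ss ≡ ℓ → All S ss → S (sum ss)

-- Raw data shared by both families of objects on the ground set [n] = Fin n:
--   an r-tuple of words (lists) over Fin n, and a list of words over Fin n.
--  * For Π: the r lists are the sets V_i (written increasingly), the other
--    list is the list of blocks of π (each written increasingly, blocks
--    listed by increasing least element).
--  * For P: the r lists are the linear orders ℓ_i, the other list is the
--    list of cycles of σ (each written as a word starting with its least
--    element, cycles listed by increasing least element).

Raw : ℕ → ℕ → Set
Raw r n = Vec (List (Fin n)) r × List (List (Fin n))

HeadLt : ∀ {n} → List (Fin n) → List (Fin n) → Set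
HeadLt (x ∷ _) (y ∷ _) = x < y
HeadLt _ _ = ⊥

ExactlyOnce : ∀ {r n} → Raw r n → Set
ExactlyOnce {r} {n} (ws , cs) = (concat (toList ws) ++ concat cs) ↭ allFin n

StartsWithLeast : ∀ {n} → List (Fin n) → Set
StartsWithLeast {n} c = ∃₂ λ (x : Fin n) (xs : List (Fin n)) → (c ≡ x ∷ xs) × All (x <_) xs

-- Π_{S,r}(n): (V, π), V an r-composition of V ⊆ [n] with |V_i| ∈ S'
-- (i.e. |V_i| + 1 ∈ S), π a partition of [n] ∖ V with block sizes in S.

IsPi : (S : ℕ → Set) → ∀ r n → Raw r n → Set
IsPi S r n (Vs , bs) =
  ExactlyOnce (Vs , bs)
  × All (Linked _<_) (toList Vs)
  × All (λ V → S (suc (length V))) (toList Vs)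
  × All (λ b → ¬ (b ≡ [])) bs
  × All (Linked _<_) bs
  × Linked HeadLt bs
  × All (λ b → S (length b)) bs

PiSet : (S : ℕ → Set) → ℕ → ℕ → ℕ → Set
PiSet S r n k = Refinement (Raw r n) (λ d → IsPi S r n d × length (Data.Product.proj₂ d) ≡ k)

LeqPi : (S : ℕ → Set) → ∀ {r n} → Raw r n → Raw r n → Set
LeqPi S {r} {n} (Vs , bs) (Vs' , bs') =
  (∀ (i : Fin r) → ∃ λ (Ts : List (List (Fin n))) →
      Unique Ts × All (_∈ bs) Ts × S (suc (length Ts))
      × (∀ x → (x ∈ lookup Vs' i) ⇔ (x ∈ lookup Vs i ⊎ Any (x ∈_) Ts)))
  × All (λ b' → ∃ λ (Us : List (List (Fin n))) →
      Unique Us × All (_∈ bs) Us × S (length Us)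
      × (∀ x → (x ∈ b') ⇔ Any (x ∈_) Us)) bs'

UpPi : (S : ℕ → Set) → ∀ r n → Raw r n → ℕ → Set
UpPi S r n p j = Refinement (Raw r n) (λ d → IsPi S r n d × LeqPi S p d × length (Data.Product.proj₂ d) ≡ j)

-- P_{S,r}(n): (ℓ, σ), ℓ_i linear orders on disjoint V_i with |V_i| ∈ S',
-- σ a permutation of [n] ∖ V with cycle lengths in S.

IsP : (S : ℕ → Set) → ∀ r n → Raw r n → Set
IsP S r n (ls , cs) =
  ExactlyOnce (ls , cs)
  × All (λ l → S (suc (length l))) (toList ls)
  × All StartsWithLeast cs
  × Linked HeadLt cs
  × All (λ c → S (length c)) cs

PSet : (S : ℕ → Set) → ℕ → ℕ → ℕ → Set
PSet S r n k = Refinement (Raw r n) (λ d → IsP S r n d × length (Data.Product.proj₂ d) ≡ k)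

LeqP : (S : ℕ → Set) → ∀ {r n} → Raw r n → Raw r n → Set
LeqP S {r} {n} (ls , cs) (ls' , cs') =
  (∀ (i : Fin r) → ∃ λ (Ts : List (List (Fin n))) →
      Unique Ts × All (_∈ cs) Ts × S (suc (length Ts))
      × lookup ls' i ≡ lookup ls i ++ concat Ts)
  × All (λ c' → ∃ λ (Us : List (List (Fin n))) →
      Unique Us × All (_∈ cs) Us × S (length Us)
      × ∃₂ λ (a b : List (Fin n)) → (concat Us ≡ a ++ b) × (c' ≡ b ++ a)) cs'

UpP : (S : ℕ → Set) → ∀ r n → Raw r n → ℕ → Set
UpP S r n q j = Refinement (Raw r n) (λ d → IsP S r n d × LeqP S q d × length (Data.Product.proj₂ d) ≡ j)

module Submission where

-- Fix a base object whose second component (the blocks of π,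
-- resp. the cycles of σ) is the list bs of k words, listed by increasing
-- least element, so that bs is indexed by Fin k.  Every object above it is
-- obtained by substituting blocks for their indices in an object on [k]:
-- a word w over Fin k becomes the concatenation cm w of the blocks it names,
-- and the i-th component Vᵢ (resp. ℓᵢ) of the base is extended by the blocks
-- named by the i-th component of the object on [k].  For P the new words
-- are literally Vᵢ ++ cm wᵢ and cm d; for Π they are the same sets written
-- in increasing order.  This "lift" is inverted by a "lower" map reading the
-- indices back: for Π, the indices of the blocks met by a set; for P, the
-- parse of a word into consecutive blocks (a cycle of σ' may be a rotation
-- of cm u, which is undone by rotating back to its least element).

open import Defs
open import Data.Nat as ℕ using (ℕ; zero; suc; _+_)
import Data.Nat.Properties as ℕP
open import Data.Fin as F using (Fin; zero; suc)
import Data.Fin.Properties as FP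
open import Data.Vec as V using (Vec; []; _∷_)
import Data.Vec.Properties as VP
open import Data.List as L using (List; []; _∷_; _++_; concat; length; allFin; map; filter)
import Data.List.Properties as LP
open import Data.List.Membership.Propositional using (_∈_; find; lose)
open import Data.List.Membership.Propositional.Properties
open import Data.List.Membership.Propositional.Properties.WithK using (unique∧set⇒bag)
open import Data.List.Relation.Binary.BagAndSetEquality using (∼bag⇒↭)
open import Data.List.Relation.Unary.All as All using (All; []; _∷_)
open import Data.List.Relation.Unary.Any as Any using (Any; here; there)
import Data.List.Relation.Unary.Any.Properties as AnyP
import Data.List.Relation.Unary.All.Properties as AllP
open import Data.List.Relation.Unary.AllPairs as AP using (AllPairs; []; _∷_)
import Data.List.Relation.Unary.AllPairs.Properties as APP
open import Data.List.Relation.Unary.Linked as Lk using (Linked; []; [-]; _∷_)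
import Data.List.Relation.Unary.Linked.Properties as LkP
open import Data.List.Relation.Unary.Unique.Propositional using (Unique)
import Data.List.Relation.Unary.Unique.Propositional.Properties as UP
open import Data.List.Relation.Binary.Permutation.Propositional using (_↭_; ↭-refl; ↭-sym; ↭-trans; prep; swap; module PermutationReasoning)
import Data.List.Relation.Binary.Permutation.Propositional.Properties as PP
open import Data.Nat.ListAction using (sum)
open import Data.Maybe using (Maybe; just; nothing)
open import Data.Product as Prod using (∃; ∃₂; _×_; _,_; proj₁; proj₂)
import Data.Product.Properties as ProdP
open import Data.Sum using (_⊎_; inj₁; inj₂)
open import Data.Empty using (⊥; ⊥-elim)
open import Relation.Nullary using (¬_; Dec; yes; no)
open import Relation.Nullary.Decidable using (recompute)
open import Relation.Binary.Definitions using (DecidableEquality; tri<; tri≈; tri>)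
open import Relation.Binary.PropositionalEquality
open import Data.Irrelevant using ([_])
open import Function.Construct.Composition using (_⇔-∘_)
open import Function.Bundles using (_⇔_; _↔_; mk↔ₛ′; Equivalence; mk⇔)
open import Data.Refinement using (Refinement; value; _,_; value-injective)

private variable
  A X : Set
  x : A
  xs ys : List A

unique-++ˡ : Unique (xs ++ ys) → Unique xs
unique-++ˡ {xs = []} u = []
unique-++ˡ {xs = x ∷ xs} (a ∷ u) = AllP.++⁻ˡ xs a ∷ unique-++ˡ u

unique-++ʳ : ∀ xs → Unique (xs ++ ys) → Unique ys
unique-++ʳ [] u = u
unique-++ʳ (x ∷ xs) (a ∷ u) = unique-++ʳ xs u

unique-++-disjoint : ∀ xs → Unique (xs ++ ys) → x ∈ xs → x ∈ ys → ⊥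
unique-++-disjoint (x ∷ xs) (a ∷ u) (here refl) m = All.lookup (AllP.++⁻ʳ xs a) m refl
unique-++-disjoint (x ∷ xs) (a ∷ u) (there p) m = unique-++-disjoint xs u p m

unique-concat-member : ∀ {xss : List (List A)} → Unique (concat xss) → xs ∈ xss → Unique xs
unique-concat-member {xss = xs ∷ xss} u (here refl) = unique-++ˡ u
unique-concat-member {xss = xs ∷ xss} u (there p) = unique-concat-member (unique-++ʳ xs u) p

unique-concat-lookup : ∀ {xss : List (List A)} → Unique (concat xss) → (a b : Fin (length xss)) →
  x ∈ L.lookup xss a → x ∈ L.lookup xss b → a ≡ b
unique-concat-lookup {xss = xs ∷ xss} u zero zero p q = refl
unique-concat-lookup {xss = xs ∷ xss} u zero (suc b) p q =
  ⊥-elim (unique-++-disjoint xs u p (∈-concat⁺′ q (∈-lookup {xs = xss} b)))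
unique-concat-lookup {xss = xs ∷ xss} u (suc a) zero p q =
  ⊥-elim (unique-++-disjoint xs u q (∈-concat⁺′ p (∈-lookup {xs = xss} a)))
unique-concat-lookup {xss = xs ∷ xss} u (suc a) (suc b) p q =
  cong suc (unique-concat-lookup {xss = xss} (unique-++ʳ xs u) a b p q)

unique-resp-↭ : xs ↭ ys → Unique xs → Unique ys
unique-resp-↭ _↭_.refl u = u
unique-resp-↭ (prep x p) (a ∷ u) = PP.All-resp-↭ p a ∷ unique-resp-↭ p u
unique-resp-↭ (swap x y p) ((x≢y ∷ ax) ∷ ay ∷ u) =
  ((λ e → x≢y (sym e)) ∷ PP.All-resp-↭ p ay) ∷ PP.All-resp-↭ p ax ∷ unique-resp-↭ p u
unique-resp-↭ (_↭_.trans p q) u = unique-resp-↭ q (unique-resp-↭ p u)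

↭allFin⇒unique : ∀ {n} {xs : List (Fin n)} → xs ↭ allFin n → Unique xs
↭allFin⇒unique p = unique-resp-↭ (↭-sym p) (UP.allFin⁺ _)

unique⇒↭ : Unique xs → Unique ys → (∀ {z} → z ∈ xs → z ∈ ys) → (∀ {z} → z ∈ ys → z ∈ xs) → xs ↭ ys
unique⇒↭ ux uy f g = ∼bag⇒↭ (unique∧set⇒bag ux uy (mk⇔ f g))

≡⇒↭ : xs ≡ ys → xs ↭ ys
≡⇒↭ refl = ↭-refl

↭-interchange : ∀ (a b c d : List A) → (a ++ b) ++ (c ++ d) ↭ (a ++ c) ++ (b ++ d)
↭-interchange a b c d =
  ↭-trans (≡⇒↭ (LP.++-assoc a b (c ++ d)))
  (↭-trans (PP.++⁺ˡ a (PP.shifts b c))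
  (≡⇒↭ (sym (LP.++-assoc a c (b ++ d)))))

concat-↭ : ∀ {xss yss : List (List A)} → xss ↭ yss → concat xss ↭ concat yss
concat-↭ _↭_.refl = ↭-refl
concat-↭ (prep xs p) = PP.++⁺ˡ xs (concat-↭ p)
concat-↭ (swap xs ys p) =
  ↭-trans (≡⇒↭ (sym (LP.++-assoc xs ys _)))
  (↭-trans (PP.++⁺ (PP.++-comm xs ys) (concat-↭ p)) (≡⇒↭ (LP.++-assoc ys xs _)))
concat-↭ (_↭_.trans p q) = ↭-trans (concat-↭ p) (concat-↭ q)

concat-vec-↭ : ∀ {r} (Xs Ys : Vec (List A) r) → (∀ i → V.lookup Xs i ↭ V.lookup Ys i) →
  concat (V.toList Xs) ↭ concat (V.toList Ys)
concat-vec-↭ [] [] h = ↭-refl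
concat-vec-↭ (X ∷ Xs) (Y ∷ Ys) h = PP.++⁺ (h zero) (concat-vec-↭ Xs Ys (λ i → h (suc i)))

concat-map-↭ : ∀ {f g : X → List A} cs → All (λ c → f c ↭ g c) cs → concat (map f cs) ↭ concat (map g cs)
concat-map-↭ [] [] = ↭-refl
concat-map-↭ (c ∷ cs) (p ∷ ps) = PP.++⁺ p (concat-map-↭ cs ps)

sorted-ext : (R : A → A → Set) → (∀ {a} → ¬ R a a) → (∀ {a b} → R a b → R b a → ⊥) →
  AllPairs R xs → AllPairs R ys → (∀ {z} → z ∈ xs → z ∈ ys) → (∀ {z} → z ∈ ys → z ∈ xs) → xs ≡ ys
sorted-ext {xs = []} {ys = []} R irr asy sx sy f g = refl
sorted-ext {xs = []} {ys = y ∷ ys} R irr asy sx sy f g with () ← g (here refl)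
sorted-ext {xs = x ∷ xs} {ys = []} R irr asy sx sy f g with () ← f (here refl)
sorted-ext {xs = x ∷ xs} {ys = y ∷ ys} R irr asy (ax ∷ sx) (ay ∷ sy) f g =
  cong₂ _∷_ x≡y (sorted-ext R irr asy sx sy f' g')
  where
  x≡y : x ≡ y
  x≡y with f (here refl) | g (here refl)
  ... | here e | _ = e
  ... | there _ | here e = sym e
  ... | there p | there q = ⊥-elim (asy (All.lookup ax q) (All.lookup ay p))
  f' : ∀ {z} → z ∈ xs → z ∈ ys
  f' {z} m with f (there m)
  ... | here refl = ⊥-elim (irr (subst (λ w → R w z) x≡y (All.lookup ax m)))
  ... | there q = q
  g' : ∀ {z} → z ∈ ys → z ∈ xs
  g' {z} m with g (there m)
  ... | here refl = ⊥-elim (irr (subst (λ w → R w z) (sym x≡y) (All.lookup ay m)))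
  ... | there q = q

fin-sorted-ext : ∀ {n} {xs ys : List (Fin n)} → AllPairs F._<_ xs → AllPairs F._<_ ys →
  (∀ {z} → z ∈ xs → z ∈ ys) → (∀ {z} → z ∈ ys → z ∈ xs) → xs ≡ ys
fin-sorted-ext = sorted-ext F._<_ (λ {a} → FP.<-irrefl refl) FP.<-asym

tabulate-sorted : ∀ {n m} (f : Fin n → Fin m) → (∀ {i j} → i F.< j → f i F.< f j) → AllPairs F._<_ (L.tabulate f)
tabulate-sorted {zero} f mono = []
tabulate-sorted {suc n} f mono =
  AllP.tabulate⁺ (λ i → mono (ℕ.s≤s ℕ.z≤n)) ∷ tabulate-sorted (λ i → f (suc i)) (λ i<j → mono (ℕ.s≤s i<j))

allFin-sorted : ∀ n → AllPairs F._<_ (allFin n)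
allFin-sorted n = tabulate-sorted (λ i → i) (λ p → p)

sorted⇒unique : ∀ {n} {xs : List (Fin n)} → AllPairs F._<_ xs → Unique xs
sorted⇒unique = AP.map (λ p e → FP.<-irrefl e p)

linked⇒sorted : ∀ {n} {xs : List (Fin n)} → Linked F._<_ xs → AllPairs F._<_ xs
linked⇒sorted = LkP.Linked⇒AllPairs FP.<-trans

sorted-lookup : ∀ {R : A → A → Set} {xs : List A} → AllPairs R xs → ∀ {i j : Fin (length xs)} → i F.< j →
  R (L.lookup xs i) (L.lookup xs j)
sorted-lookup {xs = x ∷ xs} (a ∷ ap) {zero} {suc j} lt = All.lookup a (∈-lookup j)
sorted-lookup {xs = x ∷ xs} (a ∷ ap) {suc i} {suc j} (ℕ.s≤s lt) = sorted-lookup ap lt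

sorted⇒startsWithLeast : ∀ {n} {c : List (Fin n)} → ¬ c ≡ [] → AllPairs F._<_ c → StartsWithLeast c
sorted⇒startsWithLeast {c = []} ne _ = ⊥-elim (ne refl)
sorted⇒startsWithLeast {c = h ∷ hs} ne (a ∷ _) = h , hs , refl , a

Hd : ∀ {n} → Fin n → List (Fin n) → Set
Hd x [] = ⊥
Hd x (y ∷ _) = x ≡ y

Hd? : ∀ {n} (x : Fin n) c → Dec (Hd x c)
Hd? x [] = no λ ()
Hd? x (y ∷ _) = x F.≟ y

Hd⇒∈ : ∀ {n} {x : Fin n} {c} → Hd x c → x ∈ c
Hd⇒∈ {c = y ∷ c} refl = here refl

least⇒head : ∀ {n} {L : List (Fin n)} {x} → AllPairs F._<_ L → x ∈ L → (∀ {y} → y ∈ L → y ≡ x ⊎ x F.< y) → Hd x L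
least⇒head {L = z ∷ L} s (here refl) f = refl
least⇒head {L = z ∷ L} (a ∷ s) (there m) f with f (here refl)
... | inj₁ refl = refl
... | inj₂ x<z = ⊥-elim (FP.<-asym x<z (All.lookup a m))

_∈?_ : ∀ {n} (x : Fin n) (xs : List (Fin n)) → Dec (x ∈ xs)
x ∈? xs = Any.any? (x F.≟_) xs

increasing : ∀ {n} → List (Fin n) → List (Fin n)
increasing {n} xs = filter (_∈? xs) (allFin n)

increasing-∈ : ∀ {n} {x : Fin n} {xs} → x ∈ increasing xs ⇔ x ∈ xs
increasing-∈ {n} {x} {xs} = mk⇔ (λ m → proj₂ (∈-filter⁻ (_∈? xs) {xs = allFin n} m))
                                (∈-filter⁺ (_∈? xs) {xs = allFin n} (∈-allFin x))

increasing-sorted : ∀ {n} (xs : List (Fin n)) → AllPairs F._<_ (increasing xs)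
increasing-sorted {n} xs = APP.filter⁺ (_∈? xs) (allFin-sorted n)

increasing-↭ : ∀ {n} {xs : List (Fin n)} → Unique xs → increasing xs ↭ xs
increasing-↭ {xs = xs} u = unique⇒↭ (sorted⇒unique (increasing-sorted xs)) u
  (Equivalence.to increasing-∈) (Equivalence.from increasing-∈)

increasing-[] : ∀ {n} → increasing {n} [] ≡ []
increasing-[] {n} = LP.filter-none (_∈? []) {xs = allFin n} (All.tabulate (λ _ ()))

All-toList⁻ : ∀ {r} {P : A → Set} {v : Vec A r} → All P (V.toList v) → ∀ i → P (V.lookup v i)
All-toList⁻ {v = x ∷ v} (p ∷ ps) zero = p
All-toList⁻ {v = x ∷ v} (p ∷ ps) (suc i) = All-toList⁻ ps i

All-toList⁺ : ∀ {r} {P : A → Set} {v : Vec A r} → (∀ i → P (V.lookup v i)) → All P (V.toList v)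
All-toList⁺ {v = []} f = []
All-toList⁺ {v = x ∷ v} f = f zero ∷ All-toList⁺ (λ i → f (suc i))

vec-ext : ∀ {r} {xs ys : Vec A r} → (∀ i → V.lookup xs i ≡ V.lookup ys i) → xs ≡ ys
vec-ext {xs = xs} {ys} h =
  trans (sym (VP.tabulate∘lookup xs)) (trans (VP.tabulate-cong h) (VP.tabulate∘lookup ys))

lookup∈toList : ∀ {r} (v : Vec A r) i → V.lookup v i ∈ V.toList v
lookup∈toList (x ∷ v) zero = here refl
lookup∈toList (x ∷ v) (suc i) = there (lookup∈toList v i)

drop-++ : ∀ (a b : List A) → L.drop (length a) (a ++ b) ≡ b
drop-++ [] b = refl
drop-++ (x ∷ a) b = drop-++ a b

length-concat : ∀ (xss : List (List A)) → length (concat xss) ≡ sum (map length xss)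
length-concat [] = refl
length-concat (xs ∷ xss) = trans (LP.length-++ xs) (cong (length xs +_) (length-concat xss))

map-lookup-allFin : ∀ (xs : List A) → map (L.lookup xs) (allFin (length xs)) ≡ xs
map-lookup-allFin xs = trans (LP.map-tabulate (λ i → i) (L.lookup xs)) (LP.tabulate-lookup xs)

positions : ∀ {ys Ts : List A} → All (_∈ ys) Ts → ∃ λ (w : List (Fin (length ys))) → map (L.lookup ys) w ≡ Ts
positions [] = [] , refl
positions (m ∷ ms) with positions ms
... | w , e = Any.index m ∷ w , cong₂ _∷_ (sym (AnyP.lookup-index m)) e

++-split : ∀ (p q a b : List A) → p ++ q ≡ a ++ b →
  (∃ λ m → a ≡ p ++ m × q ≡ m ++ b) ⊎ (∃₂ λ z m → p ≡ a ++ z ∷ m × b ≡ z ∷ m ++ q)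
++-split [] q a b e = inj₁ (a , refl , e)
++-split (x ∷ p) q [] b e = inj₂ (x , p , refl , sym e)
++-split (x ∷ p) q (y ∷ a) b e with refl , e' ← LP.∷-injective e with ++-split p q a b e'
... | inj₁ (m , e1 , e2) = inj₁ (m , cong (x ∷_) e1 , e2)
... | inj₂ (z , m , e1 , e2) = inj₂ (z , m , cong (x ∷_) e1 , e2)

Linked-map : ∀ {B : Set} {R : A → A → Set} {R' : B → B → Set} {P : A → Set} (f : A → B) →
  (∀ {a b} → P a → P b → R a b → R' (f a) (f b)) → Linked R xs → All P xs → Linked R' (map f xs)
Linked-map f h [] _ = []
Linked-map f h [-] _ = [-]
Linked-map f h (r ∷ rs) (pa ∷ pb ∷ ps) = h pa pb r ∷ Linked-map f h rs (pb ∷ ps)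

HeadLt-trans : ∀ {n} {a b c : List (Fin n)} → HeadLt a b → HeadLt b c → HeadLt a c
HeadLt-trans {a = x ∷ a} {y ∷ b} {z ∷ c} p q = FP.<-trans p q

HeadLt-irrefl : ∀ {n} {a : List (Fin n)} → HeadLt a a → ⊥
HeadLt-irrefl {a = x ∷ a} p = FP.<-irrefl refl p

HeadLt-asym : ∀ {n} {a b : List (Fin n)} → HeadLt a b → HeadLt b a → ⊥
HeadLt-asym {a = x ∷ a} {y ∷ b} p q = FP.<-asym p q

HeadLt-[]ʳ : ∀ {n} (a : List (Fin n)) → HeadLt a [] → ⊥
HeadLt-[]ʳ [] ()
HeadLt-[]ʳ (x ∷ a) ()

HeadLt-++ : ∀ {n} {a b : List (Fin n)} p q → HeadLt a b → HeadLt (a ++ p) (b ++ q)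
HeadLt-++ {a = x ∷ a} {y ∷ b} p q h = h

HeadLt-++⁻ : ∀ {n} {a b : List (Fin n)} p q → ¬ a ≡ [] → ¬ b ≡ [] → HeadLt (a ++ p) (b ++ q) → HeadLt a b
HeadLt-++⁻ {a = []} p q na nb h = ⊥-elim (na refl)
HeadLt-++⁻ {a = x ∷ a} {[]} p q na nb h = ⊥-elim (nb refl)
HeadLt-++⁻ {a = x ∷ a} {y ∷ b} p q na nb h = h

HeadLt-Hd : ∀ {n} {L L' : List (Fin n)} {h h'} → Hd h L → Hd h' L' → HeadLt L L' ⇔ h F.< h'
HeadLt-Hd {L = x ∷ L} {y ∷ L'} refl refl = mk⇔ (λ lt → lt) (λ lt → lt)

exactlyOnce⇒unique-words : ∀ {r n} (Ws : Vec (List (Fin n)) r) ds → ExactlyOnce (Ws , ds) →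
  ∀ i → Unique (V.lookup Ws i)
exactlyOnce⇒unique-words Ws ds e i =
  unique-concat-member (unique-++ˡ (↭allFin⇒unique e)) (lookup∈toList Ws i)

exactlyOnce⇒unique-blocks : ∀ {r n} (Ws : Vec (List (Fin n)) r) ds → ExactlyOnce (Ws , ds) →
  ∀ {d} → d ∈ ds → Unique d
exactlyOnce⇒unique-blocks Ws ds e = unique-concat-member (unique-++ʳ (concat (V.toList Ws)) (↭allFin⇒unique e))

raw-≟ : ∀ {r n} → DecidableEquality (Raw r n)
raw-≟ = ProdP.≡-dec (VP.≡-dec (LP.≡-dec F._≟_)) (LP.≡-dec (LP.≡-dec F._≟_))

-- Inverse maps between two sets that preserve the defining properties give
-- a bijection of the refinement types; proofs are irrelevant, so the
-- inverse laws are recovered through decidable equality.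
refinement-↔ : {A B : Set} {P : A → Set} {Q : B → Set} → DecidableEquality A → DecidableEquality B →
  (f : A → B) (g : B → A) → .(∀ {a} → P a → Q (f a)) → .(∀ {b} → Q b → P (g b)) →
  .(∀ {a} → P a → g (f a) ≡ a) → .(∀ {b} → Q b → f (g b) ≡ b) →
  Refinement A P ↔ Refinement B Q
refinement-↔ {A} {B} {P} {Q} _≟A_ _≟B_ f g f-ok g-ok gf fg = mk↔ₛ′ to from to-from from-to
  where
  to : Refinement A P → Refinement B Q
  to (a , [ pa ]) = f a , [ f-ok pa ]
  from : Refinement B Q → Refinement A P
  from (b , [ qb ]) = g b , [ g-ok qb ]
  to-from : ∀ y → to (from y) ≡ y
  to-from (b , [ qb ]) = value-injective (recompute (f (g b) ≟B b) (fg qb))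
  from-to : ∀ y → from (to y) ≡ y
  from-to (a , [ pa ]) = value-injective (recompute (g (f a) ≟A a) (gf pa))

module Substitution {k : ℕ} (B : Fin k → List X) where
  cm : List (Fin k) → List X
  cm w = concat (map B w)

  ext : List X → List (Fin k) → List X
  ext V w = V ++ cm w

  ∈-ext : ∀ {V W} {x : X} → x ∈ ext V W ⇔ (x ∈ V ⊎ Any (x ∈_) (map B W))
  ∈-ext {V} {W} = mk⇔ to (λ { (inj₁ m) → ∈-++⁺ˡ m ; (inj₂ a) → ∈-++⁺ʳ V (∈-concat⁺ a) })
    where
    to : ∀ {x} → x ∈ ext V W → x ∈ V ⊎ Any (x ∈_) (map B W)
    to m with ∈-++⁻ V m
    ... | inj₁ p = inj₁ p
    ... | inj₂ p = inj₂ (∈-concat⁻ (map B W) p)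

  cm-++ : ∀ (a b : List (Fin k)) → cm (a ++ b) ≡ cm a ++ cm b
  cm-++ a b = trans (cong concat (LP.map-++ B a b)) (sym (LP.concat-++ (map B a) (map B b)))

  cm-concat : ∀ (ws : List (List (Fin k))) → concat (map cm ws) ≡ cm (concat ws)
  cm-concat [] = refl
  cm-concat (w ∷ ws) = trans (cong (cm w ++_) (cm-concat ws)) (sym (cm-++ w (concat ws)))

  ext-concat : ∀ {r} (Vs : Vec (List X) r) (Ws : Vec (List (Fin k)) r) →
    concat (V.toList (V.zipWith ext Vs Ws)) ↭ concat (V.toList Vs) ++ cm (concat (V.toList Ws))
  ext-concat [] [] = ↭-refl
  ext-concat (V ∷ Vs) (W ∷ Ws) =
    ↭-trans (PP.++⁺ˡ (V ++ cm W) (ext-concat Vs Ws))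
    (↭-trans (↭-interchange V (cm W) (concat (V.toList Vs)) (cm (concat (V.toList Ws))))
    (≡⇒↭ (cong ((V ++ concat (V.toList Vs)) ++_) (sym (cm-++ W (concat (V.toList Ws)))))))

  lift-concat : ∀ {r} (Vs : Vec (List X) r) (Ws : Vec (List (Fin k)) r) (ds : List (List (Fin k))) →
    concat (V.toList (V.zipWith ext Vs Ws)) ++ concat (map cm ds)
    ↭ concat (V.toList Vs) ++ cm (concat (V.toList Ws) ++ concat ds)
  lift-concat Vs Ws ds =
    ↭-trans (PP.++⁺ (ext-concat Vs Ws) (≡⇒↭ (cm-concat ds)))
    (↭-trans (≡⇒↭ (LP.++-assoc (concat (V.toList Vs)) _ _))
    (≡⇒↭ (cong (concat (V.toList Vs) ++_) (sym (cm-++ (concat (V.toList Ws)) (concat ds))))))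

module Frame {r n : ℕ} (Vs : Vec (List (Fin n)) r) (bs : List (List (Fin n))) where
  k : ℕ
  k = length bs

  B : Fin k → List (Fin n)
  B = L.lookup bs

  open Substitution B public

  V-part : List (Fin n)
  V-part = concat (V.toList Vs)

  module WellFormed (S : ℕ → Set) (M : PlusOneMonoid S)
                    (exact : ExactlyOnce (Vs , bs)) (lead : All StartsWithLeast bs)
                    (chain : Linked HeadLt bs) (sized : All (λ b → S (length b)) bs) where
    open PlusOneMonoid M using (closed)

    all-unique : Unique (V-part ++ concat bs)
    all-unique = ↭allFin⇒unique exact

    B-disjoint : ∀ {x} t t' → x ∈ B t → x ∈ B t' → t ≡ t'
    B-disjoint t t' = unique-concat-lookup {xss = bs} (unique-++ʳ V-part all-unique) t t'

    V-B-disjoint : ∀ {x} t → x ∈ V-part → x ∈ B t → ⊥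
    V-B-disjoint t m m' = unique-++-disjoint V-part all-unique m (∈-concat⁺′ m' (∈-lookup {xs = bs} t))

    Vᵢ-B-disjoint : ∀ i {x} t → x ∈ V.lookup Vs i → x ∈ B t → ⊥
    Vᵢ-B-disjoint i t m = V-B-disjoint t (∈-concat⁺′ m (lookup∈toList Vs i))

    Vᵢ-unique : ∀ i → Unique (V.lookup Vs i)
    Vᵢ-unique = exactlyOnce⇒unique-words Vs bs exact

    B-unique : ∀ t → Unique (B t)
    B-unique t = unique-concat-member {xss = bs} (unique-++ʳ V-part all-unique) (∈-lookup t)

    B-sized : ∀ t → S (length (B t))
    B-sized t = All.lookup sized (∈-lookup t)

    B-lead : ∀ t → StartsWithLeast (B t)
    B-lead t = All.lookup lead (∈-lookup t)

    B-head : Fin k → Fin n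
    B-head t = proj₁ (B-lead t)

    B-Hd : ∀ t → Hd (B-head t) (B t)
    B-Hd t = subst (Hd (B-head t)) (sym (proj₁ (proj₂ (proj₂ (B-lead t))))) refl

    B-head∈ : ∀ t → B-head t ∈ B t
    B-head∈ t = Hd⇒∈ (B-Hd t)

    B-nonempty : ∀ t → ¬ B t ≡ []
    B-nonempty t e with () ← subst (B-head t ∈_) e (B-head∈ t)

    B-injective : ∀ {t t'} → B t ≡ B t' → t ≡ t'
    B-injective {t} {t'} e = B-disjoint t t' (B-head∈ t) (subst (B-head t ∈_) e (B-head∈ t))

    B-mono : ∀ {t t'} → t F.< t' → HeadLt (B t) (B t')
    B-mono = sorted-lookup (LkP.Linked⇒AllPairs HeadLt-trans chain)

    B-reflect : ∀ {t t'} → HeadLt (B t) (B t') → t F.< t'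
    B-reflect {t} {t'} h with FP.<-cmp t t'
    ... | tri< lt _ _ = lt
    ... | tri≈ _ refl _ = ⊥-elim (HeadLt-irrefl h)
    ... | tri> _ _ gt = ⊥-elim (HeadLt-asym h (B-mono gt))

    B-head-order : ∀ {t t'} → t F.< t' ⇔ B-head t F.< B-head t'
    B-head-order {t} {t'} = mk⇔ (λ lt → Equivalence.to heads (B-mono lt)) (λ lt → B-reflect (Equivalence.from heads lt))
      where
      heads : HeadLt (B t) (B t') ⇔ B-head t F.< B-head t'
      heads = HeadLt-Hd (B-Hd t) (B-Hd t')

    below : ∀ {t t'} → t F.< t' → ∀ {x xs} → B t ≡ x ∷ xs → All (x F.<_) (B t')
    below {t} {t'} lt {x} e with B-lead t'
    ... | y , ys , e' , ay = subst (All (x F.<_)) (sym e') (x<y ∷ All.map (FP.<-trans x<y) ay)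
      where
      x<y : x F.< y
      x<y = subst₂ HeadLt e e' (B-mono lt)

    below-cm : ∀ {t x xs} ts → B t ≡ x ∷ xs → All (t F.<_) ts → All (x F.<_) (cm ts)
    below-cm ts e lts = AllP.concat⁺ (AllP.map⁺ (All.map (λ lt → below lt e) lts))

    blocks∈ : ∀ w → All (_∈ bs) (map B w)
    blocks∈ [] = []
    blocks∈ (t ∷ w) = ∈-lookup t ∷ blocks∈ w

    in-cm : ∀ {x} W → x ∈ cm W → ∃ λ t → t ∈ W × x ∈ B t
    in-cm W m with T , xT , T∈ ← ∈-concat⁻′ (map B W) m with t , t∈ , refl ← ∈-map⁻ B T∈ = t , t∈ , xT

    map-B-unique : ∀ {w} → Unique w → Unique (map B w)
    map-B-unique = UP.map⁺ B-injective

    cm-unique : ∀ W → Unique W → Unique (cm W)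
    cm-unique [] _ = []
    cm-unique (t ∷ W) (a ∷ u) = UP.++⁺ (B-unique t) (cm-unique W u) disjoint
      where
      disjoint : ∀ {x} → x ∈ B t × x ∈ cm W → ⊥
      disjoint (m , m') with t' , t'∈ , m'' ← in-cm W m' = All.lookup a t'∈ (B-disjoint t t' m m'')

    cm-unique⁻ : ∀ W → Unique (cm W) → Unique W
    cm-unique⁻ [] _ = []
    cm-unique⁻ (t ∷ W) u = All.tabulate distinct ∷ cm-unique⁻ W (unique-++ʳ (B t) u)
      where
      distinct : ∀ {t'} → t' ∈ W → ¬ t ≡ t'
      distinct m refl = unique-++-disjoint (B t) u (B-head∈ t) (∈-concat⁺′ (B-head∈ t) (∈-map⁺ B m))

    -- The sizes: a union of s blocks with s ∈ S has size in S, and so has the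
    -- extension of Vᵢ (|Vᵢ| + 1 ∈ S) by t blocks with t + 1 ∈ S; both are
    -- instances of the closure property of a ⁺1-monoid.
    block-sizes : ∀ w → All S (map length (map B w))
    block-sizes [] = []
    block-sizes (t ∷ w) = B-sized t ∷ block-sizes w

    length-cm : ∀ w → length (cm w) ≡ sum (map length (map B w))
    length-cm w = length-concat (map B w)

    length-block-sizes : ∀ w → length (map length (map B w)) ≡ length w
    length-block-sizes w = trans (LP.length-map length (map B w)) (LP.length-map B w)

    cm-size : ∀ w → S (length w) → S (length (cm w))
    cm-size w s = subst S (sym (length-cm w)) (closed (length w) s _ (length-block-sizes w) (block-sizes w))

    ext-size : ∀ l w → S (suc (length l)) → S (suc (length w)) → S (suc (length (ext l w)))
    ext-size l w sl sw =
      subst S total (closed (suc (length w)) sw _ (cong suc (length-block-sizes w)) (sl ∷ block-sizes w))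
      where
      total : suc (length l + sum (map length (map B w))) ≡ suc (length (ext l w))
      total = cong suc (trans (cong (length l +_) (sym (length-cm w))) (sym (LP.length-++ l)))

    cm-↭ : ∀ {a b} → a ↭ b → cm a ↭ cm b
    cm-↭ p = concat-↭ (PP.map⁺ B p)

    cm-allFin : cm (allFin k) ≡ concat bs
    cm-allFin = cong concat (map-lookup-allFin bs)

    lift-exact : ∀ (Ws : Vec (List (Fin k)) r) ds →
      ExactlyOnce (Ws , ds) → ExactlyOnce (V.zipWith ext Vs Ws , map cm ds)
    lift-exact Ws ds e = begin
      concat (V.toList (V.zipWith ext Vs Ws)) ++ concat (map cm ds)
        ↭⟨ lift-concat Vs Ws ds ⟩
      V-part ++ cm (concat (V.toList Ws) ++ concat ds)
        ↭⟨ PP.++⁺ˡ V-part (cm-↭ e) ⟩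
      V-part ++ cm (allFin k)
        ≡⟨ cong (V-part ++_) cm-allFin ⟩
      V-part ++ concat bs
        ↭⟨ exact ⟩
      allFin n ∎
      where open PermutationReasoning

    -- For the converse, the head of every block must be covered by the
    -- substituted object, so every index occurs.
    lower-exact : ∀ (Ws : Vec (List (Fin k)) r) ds →
      ExactlyOnce (V.zipWith ext Vs Ws , map cm ds) → ExactlyOnce (Ws , ds)
    lower-exact Ws ds e = unique⇒↭ W-unique (UP.allFin⁺ k) (λ _ → ∈-allFin _) covered
      where
      W : List (Fin k)
      W = concat (V.toList Ws) ++ concat ds
      split : V-part ++ cm W ↭ allFin n
      split = ↭-trans (↭-sym (lift-concat Vs Ws ds)) e
      W-unique : Unique W
      W-unique = cm-unique⁻ W (unique-++ʳ V-part (↭allFin⇒unique split))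
      covered : ∀ {t} → t ∈ allFin k → t ∈ W
      covered {t} _ with ∈-++⁻ V-part (PP.∈-resp-↭ (↭-sym split) (∈-allFin (B-head t)))
      ... | inj₁ m = ⊥-elim (V-B-disjoint t m (B-head∈ t))
      ... | inj₂ m with t' , t'∈ , m' ← in-cm W m = subst (_∈ W) (B-disjoint t' t m' (B-head∈ t)) t'∈

-- Linear orders and permutations.
module CycleLifting {r n : ℕ} (ls : Vec (List (Fin n)) r) (cs : List (List (Fin n))) where
  open Frame ls cs

  block-starting : Fin n → List (Fin k) → Maybe (Fin k)
  block-starting x [] = nothing
  block-starting x (t ∷ ts) with Hd? x (B t)
  ... | yes _ = just t
  ... | no _ = block-starting x ts

  -- Cutting a word into consecutive blocks; the first argument bounds the
  -- number of blocks read and makes the recursion structural.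
  parse : ℕ → List (Fin n) → List (Fin k)
  parse zero _ = []
  parse (suc f) [] = []
  parse (suc f) (x ∷ xs) with block-starting x (allFin k)
  ... | nothing = []
  ... | just t = t ∷ parse f (L.drop (ℕ.pred (length (B t))) xs)

  decode : List (Fin n) → List (Fin k)
  decode l = parse (length l) l

  decode-after : List (Fin n) → List (Fin n) → List (Fin k)
  decode-after l l' = decode (L.drop (length l) l')

  lift : Raw r k → Raw r n
  lift (ws , ds) = V.zipWith ext ls ws , map cm ds

  lower : Raw r n → Raw r k
  lower (ls' , cs') = V.zipWith decode-after ls ls' , map decode cs'

  module Correct (S : ℕ → Set) (M : PlusOneMonoid S) (base : IsP S r n (ls , cs)) where
    open PlusOneMonoid M using (positive)

    ls-sized : All (λ l → S (suc (length l))) (V.toList ls)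
    ls-sized = proj₁ (proj₂ base)

    open WellFormed S M (proj₁ base) (proj₁ (proj₂ (proj₂ base)))
                    (proj₁ (proj₂ (proj₂ (proj₂ base)))) (proj₂ (proj₂ (proj₂ (proj₂ base))))

    block-starting-ok : ∀ {x t} ts → Hd x (B t) → t ∈ ts → block-starting x ts ≡ just t
    block-starting-ok {x} {t} (t' ∷ ts) h m with Hd? x (B t')
    ... | yes h' = cong just (B-disjoint t' t (Hd⇒∈ h') (Hd⇒∈ h))
    block-starting-ok (t' ∷ ts) h (here refl) | no ¬h = ⊥-elim (¬h h)
    block-starting-ok (t' ∷ ts) h (there m) | no ¬h = block-starting-ok ts h m

    parse-block : ∀ {x xs} rest f t → B t ≡ x ∷ xs → parse (suc f) (x ∷ xs ++ rest) ≡ t ∷ parse f rest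
    parse-block {x} {xs} rest f t e
      rewrite block-starting-ok {x} {t} (allFin k) (subst (Hd x) (sym e) refl) (∈-allFin t) | e
      = cong (λ z → t ∷ parse f z) (drop-++ xs rest)

    parse-cm : ∀ ws f → length ws ℕ.≤ f → parse f (cm ws) ≡ ws
    parse-cm [] zero _ = refl
    parse-cm [] (suc f) _ = refl
    parse-cm (t ∷ ws) (suc f) (ℕ.s≤s le) with x , xs , e , _ ← B-lead t =
      trans (cong (λ c → parse (suc f) (c ++ cm ws)) e)
            (trans (parse-block (cm ws) f t e) (cong (t ∷_) (parse-cm ws f le)))

    -- blocks are nonempty, so cm w has at least as many letters as w has indices
    length-≤-cm : ∀ ws → length ws ℕ.≤ length (cm ws)
    length-≤-cm [] = ℕ.z≤n
    length-≤-cm (t ∷ ws) = subst (suc (length ws) ℕ.≤_) (sym (LP.length-++ (B t)))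
      (ℕP.+-mono-≤ (positive (length (B t)) (B-sized t)) (length-≤-cm ws))

    decode-cm : ∀ ws → decode (cm ws) ≡ ws
    decode-cm ws = parse-cm ws (length (cm ws)) (length-≤-cm ws)

    decode-ext : ∀ l w → decode-after l (ext l w) ≡ w
    decode-ext l w = trans (cong decode (drop-++ l (cm w))) (decode-cm w)

    lower-lift : ∀ d → lower (lift d) ≡ d
    lower-lift (ws , ds) = cong₂ _,_ (words ls ws) (cycles ds)
      where
      words : ∀ {r} (ls₀ : Vec (List (Fin n)) r) ws → V.zipWith decode-after ls₀ (V.zipWith ext ls₀ ws) ≡ ws
      words [] [] = refl
      words (l ∷ ls₀) (w ∷ ws) = cong₂ _∷_ (decode-ext l w) (words ls₀ ws)
      cycles : ∀ ds → map decode (map cm ds) ≡ ds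
      cycles [] = refl
      cycles (d ∷ ds) = cong₂ _∷_ (decode-cm d) (cycles ds)

    lift-lower : ∀ ls' cs' → (∀ i → ∃ λ w → V.lookup ls' i ≡ ext (V.lookup ls i) w) →
      All (λ c' → ∃ λ u → c' ≡ cm u) cs' → lift (lower (ls' , cs')) ≡ (ls' , cs')
    lift-lower ls' cs' hw hc = cong₂ _,_ (words ls ls' hw) (cycles cs' hc)
      where
      words : ∀ {r} (ls₀ ls' : Vec (List (Fin n)) r) → (∀ i → ∃ λ w → V.lookup ls' i ≡ ext (V.lookup ls₀ i) w) →
        V.zipWith ext ls₀ (V.zipWith decode-after ls₀ ls') ≡ ls'
      words [] [] h = refl
      words (l ∷ ls₀) (l' ∷ ls') h with w , refl ← h zero =
        cong₂ _∷_ (cong (ext l) (decode-ext l w)) (words ls₀ ls' (λ i → h (suc i)))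
      cycles : ∀ cs' → All (λ c' → ∃ λ u → c' ≡ cm u) cs' → map cm (map decode cs') ≡ cs'
      cycles [] [] = refl
      cycles (_ ∷ cs') ((u , refl) ∷ h) = cong₂ _∷_ (cong cm (decode-cm u)) (cycles cs' h)

    lead-cm : ∀ {d} → StartsWithLeast d → StartsWithLeast (cm d)
    lead-cm (t , ts , refl , lt) with x , xs , e , ax ← B-lead t =
      x , xs ++ cm ts , cong (_++ cm ts) e , AllP.++⁺ ax (below-cm ts e lt)

    HeadLt-cm : ∀ {d d'} → StartsWithLeast d → StartsWithLeast d' → HeadLt d d' → HeadLt (cm d) (cm d')
    HeadLt-cm (t , ts , refl , _) (t' , ts' , refl , _) h = HeadLt-++ (cm ts) (cm ts') (B-mono h)

    HeadLt-cm⁻ : ∀ {u u'} → HeadLt (cm u) (cm u') → HeadLt u u'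
    HeadLt-cm⁻ {[]} ()
    HeadLt-cm⁻ {t ∷ ts} {[]} h = ⊥-elim (HeadLt-[]ʳ (B t ++ cm ts) h)
    HeadLt-cm⁻ {t ∷ ts} {t' ∷ ts'} h = B-reflect (HeadLt-++⁻ (cm ts) (cm ts') (B-nonempty t) (B-nonempty t') h)

    lead-cm⁻ : ∀ u → StartsWithLeast (cm u) → StartsWithLeast u
    lead-cm⁻ [] (_ , _ , () , _)
    lead-cm⁻ (t ∷ ts) (x' , xs' , e , ax') with x , xs , e₁ , _ ← B-lead t
      with refl , e₂ ← LP.∷-injective (trans (cong (_++ cm ts) (sym e₁)) e) =
      t , ts , refl , All.tabulate t<
      where
      t< : ∀ {t'} → t' ∈ ts → t F.< t'
      t< {t'} m with y , ys , e₃ , _ ← B-lead t' = B-reflect (subst₂ HeadLt (sym e₁) (sym e₃) x<y)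
        where
        y∈ : y ∈ cm ts
        y∈ = ∈-concat⁺′ (subst (y ∈_) (sym e₃) (here refl)) (∈-map⁺ B m)
        x<y : x F.< y
        x<y = All.lookup ax' (subst (y ∈_) e₂ (∈-++⁺ʳ xs y∈))

    -- If cm u = a ++ b and the first letter of b is below every
    -- letter of a, the cut between a and b is a block boundary: a cut inside
    -- a block would put a letter of that block before its least element.
    cut-inside-block : ∀ (t : Fin k) (u : List (Fin k)) (a₀ : Fin n) (a' b : List (Fin n)) (z : Fin n) (m : List (Fin n)) →
      B t ≡ (a₀ ∷ a') ++ z ∷ m →
      (∀ {y b'} → b ≡ y ∷ b' → All (y F.<_) (a₀ ∷ a')) → b ≡ z ∷ m ++ cm u → ⊥
    cut-inside-block t u a₀ a' b z m ec least eb with x , xs , e , ax ← B-lead t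
      with refl , e' ← LP.∷-injective (trans (sym e) ec) =
      FP.<-asym (All.head (least eb)) (All.lookup ax (subst (z ∈_) (sym e') (∈-++⁺ʳ a' (here refl))))

    cut-at-boundary : ∀ (u : List (Fin k)) (a b : List (Fin n)) → cm u ≡ a ++ b →
      (∀ {y b'} → b ≡ y ∷ b' → All (y F.<_) a) → ∃₂ λ w v → u ≡ w ++ v × cm w ≡ a × cm v ≡ b
    cut-at-boundary [] [] [] e least = [] , [] , refl , refl , refl
    cut-at-boundary (t ∷ u) a b e least with ++-split (B t) (cm u) a b e
    ... | inj₁ (m , ea , em) with w , v , e₁ , e₂ , e₃ ← cut-at-boundary u m b em (λ eb → AllP.++⁻ʳ (B t) (subst (All _) ea (least eb))) =
      t ∷ w , v , cong (t ∷_) e₁ , trans (cong (B t ++_) e₂) (sym ea) , e₃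
    cut-at-boundary (t ∷ u) [] b e least | inj₂ _ = [] , t ∷ u , refl , refl , e
    cut-at-boundary (t ∷ u) (a₀ ∷ a') b e least | inj₂ (z , m , ec , eb) = ⊥-elim (cut-inside-block t u a₀ a' b z m ec least eb)

    rotation-least : ∀ {c'} (a b : List (Fin n)) → StartsWithLeast c' → c' ≡ b ++ a →
      ∀ {y b'} → b ≡ y ∷ b' → All (y F.<_) a
    rotation-least a b (x , xs , ec , ax) e {b' = b'} refl with refl , e' ← LP.∷-injective (trans (sym ec) e) =
      AllP.++⁻ʳ b' (subst (All (x F.<_)) e' ax)

    -- A cycle of σ' is a rotation of a concatenation of cycles of σ; being
    -- written from its least element, it is the substitution of a word.
    decompose-cycle : ∀ {c'} → StartsWithLeast c' →
      (∃ λ (Us : List (List (Fin n))) → Unique Us × All (_∈ cs) Us × S (length Us)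
        × ∃₂ λ (a b : List (Fin n)) → (concat Us ≡ a ++ b) × (c' ≡ b ++ a)) →
      ∃ λ u → c' ≡ cm u × S (length u)
    decompose-cycle {c'} lc (Us , _ , Us∈ , sU , a , b , e₁ , e₂) with u₀ , eu ← positions Us∈
      with w , v , e₃ , e₄ , e₅ ← cut-at-boundary u₀ a b (trans (cong concat eu) e₁) (rotation-least a b lc e₂) =
      v ++ w , trans e₂ (trans (cong₂ _++_ (sym e₅) (sym e₄)) (sym (cm-++ v w))) , subst S (sym same-length) sU
      where
      open ≡-Reasoning
      same-length : length (v ++ w) ≡ length Us
      same-length = begin
        length (v ++ w)        ≡⟨ LP.length-++-comm v w ⟩
        length (w ++ v)        ≡⟨ cong length (sym e₃) ⟩
        length u₀              ≡⟨ sym (LP.length-map B u₀) ⟩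
        length (map B u₀)      ≡⟨ cong length eu ⟩
        length Us              ∎

    lift-IsP : ∀ {ws ds} → IsP S r k (ws , ds) → IsP S r n (lift (ws , ds))
    lift-IsP {ws} {ds} (e , ws-sized , ds-lead , ds-chain , ds-sized) =
      lift-exact ws ds e , All-toList⁺ extended-sized , AllP.map⁺ (All.map lead-cm ds-lead)
      , Linked-map cm HeadLt-cm ds-chain ds-lead , AllP.map⁺ (All.map (λ {d} → cm-size d) ds-sized)
      where
      extended-sized : ∀ i → S (suc (length (V.lookup (V.zipWith ext ls ws) i)))
      extended-sized i = subst (λ z → S (suc (length z))) (sym (VP.lookup-zipWith ext i ls ws))
        (ext-size (V.lookup ls i) (V.lookup ws i) (All-toList⁻ ls-sized i) (All-toList⁻ ws-sized i))

    lift-above : ∀ {ws ds} → IsP S r k (ws , ds) → LeqP S (ls , cs) (lift (ws , ds))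
    lift-above {ws} {ds} (e , ws-sized , _ , _ , ds-sized) = words , AllP.map⁺ (All.tabulate cycle)
      where
      words : ∀ i → ∃ λ (Ts : List (List (Fin n))) → Unique Ts × All (_∈ cs) Ts × S (suc (length Ts))
                      × V.lookup (V.zipWith ext ls ws) i ≡ V.lookup ls i ++ concat Ts
      words i = map B (V.lookup ws i) , map-B-unique (exactlyOnce⇒unique-words ws ds e i) , blocks∈ _
        , subst (λ z → S (suc z)) (sym (LP.length-map B (V.lookup ws i))) (All-toList⁻ ws-sized i)
        , VP.lookup-zipWith ext i ls ws
      cycle : ∀ {d} → d ∈ ds → ∃ λ (Us : List (List (Fin n))) → Unique Us × All (_∈ cs) Us × S (length Us)
                × ∃₂ λ (a b : List (Fin n)) → (concat Us ≡ a ++ b) × (cm d ≡ b ++ a)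
      cycle {d} m = map B d , map-B-unique (exactlyOnce⇒unique-blocks ws ds e m) , blocks∈ d
        , subst S (sym (LP.length-map B d)) (All.lookup ds-sized m) , [] , cm d , refl , sym (LP.++-identityʳ (cm d))

    module Above (ls' : Vec (List (Fin n)) r) (cs' : List (List (Fin n)))
                 (up : IsP S r n (ls' , cs')) (above : LeqP S (ls , cs) (ls' , cs')) where
      word-decomposition : ∀ i → ∃ λ w → V.lookup ls' i ≡ ext (V.lookup ls i) w × S (suc (length w))
      word-decomposition i with Ts , _ , Ts∈ , sT , e ← proj₁ above i with w , ew ← positions Ts∈ =
        w , trans e (cong (λ z → V.lookup ls i ++ concat z) (sym ew))
        , subst (λ z → S (suc z)) (trans (sym (cong length ew)) (LP.length-map B w)) sT

      cycle-decomposition : All (λ c' → ∃ λ u → c' ≡ cm u × S (length u)) cs'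
      cycle-decomposition = All.tabulate (λ m →
        decompose-cycle (All.lookup (proj₁ (proj₂ (proj₂ up))) m) (All.lookup (proj₂ above) m))

      lift-lower-above : lift (lower (ls' , cs')) ≡ (ls' , cs')
      lift-lower-above = lift-lower ls' cs' (λ i → Prod.map₂ proj₁ (word-decomposition i))
                                            (All.map (Prod.map₂ proj₁) cycle-decomposition)

      lower-word : ∀ i w → V.lookup ls' i ≡ ext (V.lookup ls i) w → V.lookup (proj₁ (lower (ls' , cs'))) i ≡ w
      lower-word i w e = begin
        V.lookup (V.zipWith decode-after ls ls') i   ≡⟨ VP.lookup-zipWith decode-after i ls ls' ⟩
        decode-after (V.lookup ls i) (V.lookup ls' i) ≡⟨ cong (decode-after (V.lookup ls i)) e ⟩
        decode-after (V.lookup ls i) (ext (V.lookup ls i) w) ≡⟨ decode-ext (V.lookup ls i) w ⟩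
        w ∎
        where open ≡-Reasoning

      -- The lowering inherits every defining property through the lift.
      lower-IsP : IsP S r k (lower (ls' , cs'))
      lower-IsP with lifted ← subst (IsP S r n) (sym lift-lower-above) up =
        lower-exact ws ds (proj₁ lifted)
        , All-toList⁺ word-sized
        , All.map (λ {u} → lead-cm⁻ u) (AllP.map⁻ (proj₁ (proj₂ (proj₂ lifted))))
        , Lk.map HeadLt-cm⁻ (LkP.map⁻ (proj₁ (proj₂ (proj₂ (proj₂ lifted)))))
        , AllP.map⁺ (All.map (λ (u , e , s) → subst (λ z → S (length z)) (sym (trans (cong decode e) (decode-cm u))) s)
                             cycle-decomposition)
        where
        ws : Vec (List (Fin k)) r
        ws = proj₁ (lower (ls' , cs'))
        ds : List (List (Fin k))
        ds = proj₂ (lower (ls' , cs'))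
        word-sized : ∀ i → S (suc (length (V.lookup ws i)))
        word-sized i with w , e , s ← word-decomposition i = subst (λ z → S (suc (length z))) (sym (lower-word i w e)) s

  up-↔ : (S : ℕ → Set) → PlusOneMonoid S → .(IsP S r n (ls , cs)) → ∀ j → UpP S r n (ls , cs) j ↔ PSet S r k j
  up-↔ S M base j = refinement-↔ raw-≟ raw-≟ lower lift
    (λ { {ls' , cs'} (up , above , len) →
         Correct.Above.lower-IsP S M base ls' cs' up above , trans (LP.length-map decode cs') len })
    (λ { {ws , ds} (ip , len) →
         Correct.lift-IsP S M base ip , Correct.lift-above S M base ip , trans (LP.length-map cm ds) len })
    (λ { {ls' , cs'} (up , above , _) → Correct.Above.lift-lower-above S M base ls' cs' up above })
    (λ (_ , _) → Correct.lower-lift S M base _)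

-- Set compositions and set partitions.
module BlockLifting {r n : ℕ} (Vs : Vec (List (Fin n)) r) (bs : List (List (Fin n))) where
  open Frame Vs bs

  extension : List (Fin n) → List (Fin k) → List (Fin n)
  extension V W = increasing (ext V W)

  union : List (Fin k) → List (Fin n)
  union c = increasing (cm c)

  Meets : List (Fin n) → Fin k → Set
  Meets X t = Any (_∈ X) (B t)

  Meets? : ∀ X t → Dec (Meets X t)
  Meets? X t = Any.any? (_∈? X) (B t)

  met : List (Fin n) → List (Fin k)
  met X = filter (Meets? X) (allFin k)

  lift : Raw r k → Raw r n
  lift (Ws , cs) = V.zipWith extension Vs Ws , map union cs

  lower : Raw r n → Raw r k
  lower (Vs' , bs') = V.map met Vs' , map met bs'

  met-∈ : ∀ {X t} → t ∈ met X ⇔ Meets X t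
  met-∈ {X} {t} = mk⇔ (λ m → proj₂ (∈-filter⁻ (Meets? X) {xs = allFin k} m))
                      (∈-filter⁺ (Meets? X) {xs = allFin k} (∈-allFin t))

  met-sorted : ∀ X → AllPairs F._<_ (met X)
  met-sorted X = APP.filter⁺ (Meets? X) (allFin-sorted k)

  module Correct (S : ℕ → Set) (M : PlusOneMonoid S) (base : IsPi S r n (Vs , bs)) where
    Vs-sized : All (λ V → S (suc (length V))) (V.toList Vs)
    Vs-sized = proj₁ (proj₂ (proj₂ base))

    bs-sorted : All (Linked F._<_) bs
    bs-sorted = proj₁ (proj₂ (proj₂ (proj₂ (proj₂ base))))

    bs-lead : All StartsWithLeast bs
    bs-lead = All.tabulate (λ m → sorted⇒startsWithLeast (All.lookup (proj₁ (proj₂ (proj₂ (proj₂ base)))) m)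
                                                         (linked⇒sorted (All.lookup bs-sorted m)))

    open WellFormed S M (proj₁ base) bs-lead (proj₁ (proj₂ (proj₂ (proj₂ (proj₂ (proj₂ base))))))
                    (proj₂ (proj₂ (proj₂ (proj₂ (proj₂ (proj₂ base))))))

    Disjoint : List (Fin n) → Set
    Disjoint V = ∀ {x} t → x ∈ V → x ∈ B t → ⊥

    ext-unique : ∀ {V W} → Unique V → Disjoint V → Unique W → Unique (ext V W)
    ext-unique {V} {W} uV dV uW = UP.++⁺ uV (cm-unique W uW) (λ (m , m') → dV (proj₁ (in-cm W m')) m (proj₂ (proj₂ (in-cm W m'))))

    extension-↭ : ∀ {V W} → Unique V → Disjoint V → Unique W → extension V W ↭ ext V W
    extension-↭ uV dV uW = increasing-↭ (ext-unique uV dV uW)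

    union-↭ : ∀ {c} → Unique c → union c ↭ cm c
    union-↭ = extension-↭ [] (λ _ ())

    met-extension : ∀ {V W} → Disjoint V → AllPairs F._<_ W → met (extension V W) ≡ W
    met-extension {V} {W} dV sW = fin-sorted-ext (met-sorted _) sW added (λ m → Equivalence.from met-∈ (meets m))
      where
      added : ∀ {t} → t ∈ met (extension V W) → t ∈ W
      added m with y , yB , y∈ ← find (Equivalence.to met-∈ m)
        with Equivalence.to (∈-ext {V} {W}) (Equivalence.to increasing-∈ y∈)
      ... | inj₁ yV = ⊥-elim (dV _ yV yB)
      ... | inj₂ a with t' , t'∈ , yB' ← in-cm W (∈-concat⁺ a) = subst (_∈ W) (sym (B-disjoint _ t' yB yB')) t'∈
      meets : ∀ {t} → t ∈ W → Meets (extension V W) t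
      meets {t} m = lose (B-head∈ t) (Equivalence.from increasing-∈
        (Equivalence.from (∈-ext {V} {W}) (inj₂ (lose (∈-map⁺ B m) (B-head∈ t)))))

    union-head : ∀ t c → AllPairs F._<_ (t ∷ c) → Hd (B-head t) (union (t ∷ c))
    union-head t c (t<c ∷ _) with B-lead t
    ... | h , hs , e , h<hs = least⇒head (increasing-sorted _) (Equivalence.from increasing-∈ h∈) least
      where
      h∈ : h ∈ cm (t ∷ c)
      h∈ = ∈-++⁺ˡ (subst (h ∈_) (sym e) (here refl))
      least : ∀ {y} → y ∈ union (t ∷ c) → y ≡ h ⊎ h F.< y
      least m with ∈-++⁻ (B t) (Equivalence.to increasing-∈ m)
      ... | inj₁ yB with subst (_ ∈_) e yB
      ...   | here refl = inj₁ refl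
      ...   | there q = inj₂ (All.lookup h<hs q)
      least m | inj₂ yc with t' , t'∈ , yB ← in-cm c yc = inj₂ (All.lookup (below (All.lookup t<c t'∈) e) yB)

    NonemptySorted : List (Fin k) → Set
    NonemptySorted c = ¬ c ≡ [] × AllPairs F._<_ c

    HeadLt-union : ∀ {c c'} → NonemptySorted c → NonemptySorted c' → HeadLt c c' ⇔ HeadLt (union c) (union c')
    HeadLt-union {[]} (ne , _) _ = ⊥-elim (ne refl)
    HeadLt-union {t ∷ c} {[]} _ (ne , _) = ⊥-elim (ne refl)
    HeadLt-union {t ∷ c} {t' ∷ c'} (_ , s) (_ , s') =
      mk⇔ (λ lt → Equivalence.from heads (Equivalence.to B-head-order lt))
          (λ lt → Equivalence.from B-head-order (Equivalence.to heads lt))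
      where
      heads : HeadLt (union (t ∷ c)) (union (t' ∷ c')) ⇔ B-head t F.< B-head t'
      heads = HeadLt-Hd (union-head t c s) (union-head t' c' s')

    union-nonempty : ∀ {c} → ¬ c ≡ [] → ¬ union c ≡ []
    union-nonempty {[]} ne = ⊥-elim (ne refl)
    union-nonempty {t ∷ c} ne e with () ← subst (B-head t ∈_) e
      (Equivalence.from increasing-∈ (∈-++⁺ˡ (B-head∈ t)))

    module Part (V X : List (Fin n)) (Ts : List (List (Fin n))) (dV : Disjoint V)
                (Ts∈ : All (_∈ bs) Ts) (spec : ∀ x → (x ∈ X) ⇔ (x ∈ V ⊎ Any (x ∈_) Ts)) where
      block-of : ∀ {T} → T ∈ Ts → ∃ λ t → T ≡ B t
      block-of m = Any.index (All.lookup Ts∈ m) , AnyP.lookup-index (All.lookup Ts∈ m)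

      meets⇒ : ∀ {t} → Meets X t → B t ∈ Ts
      meets⇒ {t} a with y , yB , yX ← find a with Equivalence.to (spec y) yX
      ... | inj₁ yV = ⊥-elim (dV t yV yB)
      ... | inj₂ b with T , T∈ , yT ← find b with t' , refl ← block-of T∈ =
        subst (_∈ Ts) (cong B (sym (B-disjoint t t' yB yT))) T∈

      ⇒met : ∀ {T} → T ∈ Ts → ∃ λ t → T ≡ B t × t ∈ met X
      ⇒met m with t , refl ← block-of m =
        t , refl , Equivalence.from met-∈ (lose (B-head∈ t) (Equivalence.from (spec _) (inj₂ (lose m (B-head∈ t)))))

      extension-met : AllPairs F._<_ X → extension V (met X) ≡ X
      extension-met sX = fin-sorted-ext (increasing-sorted _) sX into (λ m → Equivalence.from (∈-extension-met) (Equivalence.to (spec _) m))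
        where
        ∈-extension-met : ∀ {x} → x ∈ extension V (met X) ⇔ (x ∈ V ⊎ Any (x ∈_) Ts)
        ∈-extension-met = mk⇔ to from ⇔-∘ (∈-ext {V} {met X} ⇔-∘ increasing-∈)
          where
          to : ∀ {x} → x ∈ V ⊎ Any (x ∈_) (map B (met X)) → x ∈ V ⊎ Any (x ∈_) Ts
          to (inj₁ xV) = inj₁ xV
          to (inj₂ a) with t , t∈ , xB ← in-cm (met X) (∈-concat⁺ a) =
            inj₂ (lose (meets⇒ (Equivalence.to met-∈ t∈)) xB)
          from : ∀ {x} → x ∈ V ⊎ Any (x ∈_) Ts → x ∈ V ⊎ Any (x ∈_) (map B (met X))
          from (inj₁ xV) = inj₁ xV
          from (inj₂ a) with T , T∈ , xT ← find a with t , refl , t∈ ← ⇒met T∈ = inj₂ (lose (∈-map⁺ B t∈) xT)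
        into : ∀ {x} → x ∈ extension V (met X) → x ∈ X
        into m = Equivalence.from (spec _) (Equivalence.to ∈-extension-met m)

      length-met : Unique Ts → length (met X) ≡ length Ts
      length-met uT = trans (sym (LP.length-map B (met X)))
        (PP.↭-length (unique⇒↭ (map-B-unique (sorted⇒unique (met-sorted X))) uT named (λ m → named⁻ m)))
        where
        named : ∀ {T} → T ∈ map B (met X) → T ∈ Ts
        named m with t , t∈ , refl ← ∈-map⁻ B m = meets⇒ (Equivalence.to met-∈ t∈)
        named⁻ : ∀ {T} → T ∈ Ts → T ∈ map B (met X)
        named⁻ m with t , refl , t∈ ← ⇒met m = ∈-map⁺ B t∈

    lift-↭ : ∀ Ws cs → (∀ i → Unique (V.lookup Ws i)) → All Unique cs →
      concat (V.toList (V.zipWith extension Vs Ws)) ++ concat (map union cs)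
      ↭ concat (V.toList (V.zipWith ext Vs Ws)) ++ concat (map cm cs)
    lift-↭ Ws cs uW uc = PP.++⁺ (concat-vec-↭ (V.zipWith extension Vs Ws) (V.zipWith ext Vs Ws) word) (concat-map-↭ cs (All.map union-↭ uc))
      where
      word : ∀ i → V.lookup (V.zipWith extension Vs Ws) i ↭ V.lookup (V.zipWith ext Vs Ws) i
      word i = ↭-trans (≡⇒↭ (VP.lookup-zipWith extension i Vs Ws))
        (↭-trans (extension-↭ (Vᵢ-unique i) (Vᵢ-B-disjoint i) (uW i)) (≡⇒↭ (sym (VP.lookup-zipWith ext i Vs Ws))))

    lift-IsPi : ∀ {Ws cs} → IsPi S r k (Ws , cs) → IsPi S r n (lift (Ws , cs))
    lift-IsPi {Ws} {cs} (e , Ws-sorted , Ws-sized , cs-nonempty , cs-sorted , cs-chain , cs-sized) =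
      ↭-trans (lift-↭ Ws cs W-unique (All.tabulate c-unique)) (lift-exact Ws cs e)
      , All-toList⁺ (λ i → subst (Linked F._<_) (sym (VP.lookup-zipWith extension i Vs Ws))
                                 (LkP.AllPairs⇒Linked (increasing-sorted _)))
      , All-toList⁺ extension-sized
      , AllP.map⁺ (All.map union-nonempty cs-nonempty)
      , AllP.map⁺ (All.tabulate (λ _ → LkP.AllPairs⇒Linked (increasing-sorted _)))
      , Linked-map union (λ p q → Equivalence.to (HeadLt-union p q)) cs-chain
                   (All.tabulate (λ m → All.lookup cs-nonempty m , c-sorted m))
      , AllP.map⁺ (All.tabulate union-sized)
      where
      W-unique : ∀ i → Unique (V.lookup Ws i)
      W-unique i = sorted⇒unique (linked⇒sorted (All-toList⁻ Ws-sorted i))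
      c-sorted : ∀ {c} → c ∈ cs → AllPairs F._<_ c
      c-sorted m = linked⇒sorted (All.lookup cs-sorted m)
      c-unique : ∀ {c} → c ∈ cs → Unique c
      c-unique m = sorted⇒unique (c-sorted m)
      extension-sized : ∀ i → S (suc (length (V.lookup (V.zipWith extension Vs Ws) i)))
      extension-sized i = subst (λ z → S (suc (length z))) (sym (VP.lookup-zipWith extension i Vs Ws))
        (subst (λ z → S (suc z)) (sym (PP.↭-length (extension-↭ (Vᵢ-unique i) (Vᵢ-B-disjoint i) (W-unique i))))
          (ext-size (V.lookup Vs i) (V.lookup Ws i) (All-toList⁻ Vs-sized i) (All-toList⁻ Ws-sized i)))
      union-sized : ∀ {c} → c ∈ cs → S (length (union c))
      union-sized {c} m = subst S (sym (PP.↭-length (union-↭ (c-unique m)))) (cm-size c (All.lookup cs-sized m))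

    lift-above : ∀ {Ws cs} → IsPi S r k (Ws , cs) → LeqPi S (Vs , bs) (lift (Ws , cs))
    lift-above {Ws} {cs} (_ , Ws-sorted , Ws-sized , _ , cs-sorted , _ , cs-sized) = word , AllP.map⁺ (All.tabulate block)
      where
      word : ∀ i → ∃ λ (Ts : List (List (Fin n))) → Unique Ts × All (_∈ bs) Ts × S (suc (length Ts))
                     × (∀ x → (x ∈ V.lookup (V.zipWith extension Vs Ws) i) ⇔ (x ∈ V.lookup Vs i ⊎ Any (x ∈_) Ts))
      word i = map B (V.lookup Ws i) , map-B-unique (sorted⇒unique (linked⇒sorted (All-toList⁻ Ws-sorted i)))
        , blocks∈ _ , subst (λ z → S (suc z)) (sym (LP.length-map B (V.lookup Ws i))) (All-toList⁻ Ws-sized i)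
        , λ x → (∈-ext ⇔-∘ increasing-∈) ⇔-∘
                  mk⇔ (subst (x ∈_) (VP.lookup-zipWith extension i Vs Ws)) (subst (x ∈_) (sym (VP.lookup-zipWith extension i Vs Ws)))
      block : ∀ {c} → c ∈ cs → ∃ λ (Us : List (List (Fin n))) → Unique Us × All (_∈ bs) Us × S (length Us)
                × (∀ x → (x ∈ union c) ⇔ Any (x ∈_) Us)
      block {c} m = map B c , map-B-unique (sorted⇒unique (linked⇒sorted (All.lookup cs-sorted m))) , blocks∈ c
        , subst S (sym (LP.length-map B c)) (All.lookup cs-sized m)
        , λ x → mk⇔ (∈-concat⁻ (map B c)) ∈-concat⁺ ⇔-∘ increasing-∈

    lower-lift : ∀ {Ws cs} → IsPi S r k (Ws , cs) → lower (lift (Ws , cs)) ≡ (Ws , cs)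
    lower-lift {Ws} {cs} (_ , Ws-sorted , _ , _ , cs-sorted , _ , _) =
      cong₂ _,_ (vec-ext word) (trans (sym (LP.map-∘ cs)) (LP.map-id-local (All.tabulate block)))
      where
      word : ∀ i → V.lookup (V.map met (V.zipWith extension Vs Ws)) i ≡ V.lookup Ws i
      word i = trans (VP.lookup-map i met (V.zipWith extension Vs Ws))
        (trans (cong met (VP.lookup-zipWith extension i Vs Ws))
          (met-extension (Vᵢ-B-disjoint i) (linked⇒sorted (All-toList⁻ Ws-sorted i))))
      block : ∀ {c} → c ∈ cs → met (union c) ≡ c
      block m = met-extension (λ _ ()) (linked⇒sorted (All.lookup cs-sorted m))

    module Above (Vs' : Vec (List (Fin n)) r) (bs' : List (List (Fin n)))
                 (up : IsPi S r n (Vs' , bs')) (above : LeqPi S (Vs , bs) (Vs' , bs')) where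
      Vs'-sorted : All (Linked F._<_) (V.toList Vs')
      Vs'-sorted = proj₁ (proj₂ up)

      bs'-sorted : All (Linked F._<_) bs'
      bs'-sorted = proj₁ (proj₂ (proj₂ (proj₂ (proj₂ up))))

      as-part : ∀ {b' : List (Fin n)} {Us : List (List (Fin n))} →
        (∀ x → (x ∈ b') ⇔ Any (x ∈_) Us) → ∀ x → (x ∈ b') ⇔ (x ∈ [] ⊎ Any (x ∈_) Us)
      as-part spec x = mk⇔ (λ m → inj₂ (Equivalence.to (spec x) m))
                           (λ { (inj₁ ()) ; (inj₂ a) → Equivalence.from (spec x) a })

      word-recovered : ∀ i → extension (V.lookup Vs i) (met (V.lookup Vs' i)) ≡ V.lookup Vs' i
      word-recovered i with Ts , _ , Ts∈ , _ , spec ← proj₁ above i =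
        Part.extension-met (V.lookup Vs i) (V.lookup Vs' i) Ts (Vᵢ-B-disjoint i) Ts∈ spec
                           (linked⇒sorted (All-toList⁻ Vs'-sorted i))

      word-sized : ∀ i → S (suc (length (met (V.lookup Vs' i))))
      word-sized i with Ts , uT , Ts∈ , sT , spec ← proj₁ above i =
        subst (λ z → S (suc z)) (sym (Part.length-met (V.lookup Vs i) (V.lookup Vs' i) Ts (Vᵢ-B-disjoint i) Ts∈ spec uT)) sT

      block-recovered : ∀ {b'} → b' ∈ bs' → union (met b') ≡ b'
      block-recovered {b'} m with Us , _ , Us∈ , _ , spec ← All.lookup (proj₂ above) m =
        Part.extension-met [] b' Us (λ _ ()) Us∈ (as-part spec) (linked⇒sorted (All.lookup bs'-sorted m))

      block-sized : ∀ {b'} → b' ∈ bs' → S (length (met b'))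
      block-sized {b'} m with Us , uU , Us∈ , sU , spec ← All.lookup (proj₂ above) m =
        subst S (sym (Part.length-met [] b' Us (λ _ ()) Us∈ (as-part spec) uU)) sU

      lift-lower-above : lift (lower (Vs' , bs')) ≡ (Vs' , bs')
      lift-lower-above = cong₂ _,_ (vec-ext word) (trans (sym (LP.map-∘ bs')) (LP.map-id-local (All.tabulate block-recovered)))
        where
        word : ∀ i → V.lookup (V.zipWith extension Vs (V.map met Vs')) i ≡ V.lookup Vs' i
        word i = trans (VP.lookup-zipWith extension i Vs (V.map met Vs'))
          (trans (cong (extension (V.lookup Vs i)) (VP.lookup-map i met Vs')) (word-recovered i))

      lower-IsPi : IsPi S r k (lower (Vs' , bs'))
      lower-IsPi with lifted ← subst (IsPi S r n) (sym lift-lower-above) up =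
        lower-exact Ws cs (↭-trans (↭-sym (lift-↭ Ws cs W-unique (AllP.map⁺ (All.tabulate (λ _ → met-unique _))))) (proj₁ lifted))
        , All-toList⁺ (λ i → subst (Linked F._<_) (sym (VP.lookup-map i met Vs')) (LkP.AllPairs⇒Linked (met-sorted _)))
        , All-toList⁺ (λ i → subst (λ z → S (suc (length z))) (sym (VP.lookup-map i met Vs')) (word-sized i))
        , AllP.map⁺ nonempty
        , AllP.map⁺ (All.tabulate (λ _ → LkP.AllPairs⇒Linked (met-sorted _)))
        , Linked-map met (λ p q → Equivalence.from (HeadLt-union p q))
                     (LkP.map⁻ (LkP.map⁻ (proj₁ (proj₂ (proj₂ (proj₂ (proj₂ (proj₂ lifted))))))))
                     (All.map (λ {b'} ne → ne , met-sorted b') nonempty)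
        , AllP.map⁺ (All.tabulate block-sized)
        where
        Ws : Vec (List (Fin k)) r
        Ws = proj₁ (lower (Vs' , bs'))
        cs : List (List (Fin k))
        cs = proj₂ (lower (Vs' , bs'))
        met-unique : ∀ X → Unique (met X)
        met-unique X = sorted⇒unique (met-sorted X)
        W-unique : ∀ i → Unique (V.lookup Ws i)
        W-unique i = subst Unique (sym (VP.lookup-map i met Vs')) (met-unique _)
        nonempty : All (λ b' → ¬ met b' ≡ []) bs'
        nonempty = All.map (λ ne e → ne (trans (cong union e) increasing-[]))
                           (AllP.map⁻ (AllP.map⁻ (proj₁ (proj₂ (proj₂ (proj₂ lifted))))))

  up-↔ : (S : ℕ → Set) → PlusOneMonoid S → .(IsPi S r n (Vs , bs)) → ∀ j → UpPi S r n (Vs , bs) j ↔ PiSet S r k j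
  up-↔ S M base j = refinement-↔ raw-≟ raw-≟ lower lift
    (λ { {Vs' , bs'} (up , above , len) →
         Correct.Above.lower-IsPi S M base Vs' bs' up above , trans (LP.length-map met bs') len })
    (λ { {Ws , cs} (ip , len) →
         Correct.lift-IsPi S M base ip , Correct.lift-above S M base ip , trans (LP.length-map union cs) len })
    (λ { {Vs' , bs'} (up , above , _) → Correct.Above.lift-lower-above S M base Vs' bs' up above })
    (λ (ip , _) → Correct.lower-lift S M base ip)

lemma5p6 : (S : ℕ → Set) → PlusOneMonoid S → (r n k : ℕ) →
    ((p : PiSet S r n k) → (j : ℕ) → UpPi S r n (value p) j ↔ PiSet S r k j)
    × ((q : PSet S r n k) → (j : ℕ) → UpP S r n (value q) j ↔ PSet S r k j)
lemma5p6 S M r n k = partitions , permutations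
  where
  partitions : (p : PiSet S r n k) → (j : ℕ) → UpPi S r n (value p) j ↔ PiSet S r k j
  partitions ((Vs , bs) , [ prf ]) j =
    subst (λ m → UpPi S r n (Vs , bs) j ↔ PiSet S r m j) (recompute (length bs ℕ.≟ k) (proj₂ prf))
          (BlockLifting.up-↔ Vs bs S M (proj₁ prf) j)

  permutations : (q : PSet S r n k) → (j : ℕ) → UpP S r n (value q) j ↔ PSet S r k j
  permutations ((ls , cs) , [ prf ]) j =
    subst (λ m → UpP S r n (ls , cs) j ↔ PSet S r m j) (recompute (length cs ℕ.≟ k) (proj₂ prf))
          (CycleLifting.up-↔ ls cs S M (proj₁ prf) j)
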